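{- Let $q$ be a prime power and $m$ a positive integer dividing $q-1$, and let $\alpha_n,\beta_n,\gamma_n$ ($n\ge1$) be as defined below. Then for all $n$ for which the indices are $\ge1$: $\alpha_{2n}=\alpha_{2n-1}+(q-1)\beta_{2n-1}$, $\alpha_{2n+1}=q\alpha_{2n}$, $\beta_n=q\beta_{n-1}+(n\bmod 2)=(q-1-m)\alpha_{n-1}+\beta_{n-1}+m\gamma_{n-1}-((n-1)\bmod 2)$, $\gamma_{2n}=(q-1)\beta_{2n-1}+\gamma_{2n-1}$, $\gamma_{2n+1}=q\gamma_{2n}$.
   Context: Here $j\bmod 2\in\{0,1\}$. Put $k(n)=\lfloor (n-1)/2\rfloor$ and $\beta_n=q^{(n-1)\bmod 2}\frac{q^{2k(n)}-1}{q^2-1}$, $\alpha_n=\beta_n-\frac{q^{k(n)}-1}{q-1}$, $\gamma_n=\alpha_n+\frac{q^{k(n)}}{m}$, for $n\ge1$. -}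

module Defs where

open import Data.Nat as ℕ using (ℕ; zero; suc; _∸_; _^_; _≥_; _%_)
open import Data.Nat.Primality using (Prime)
open import Data.Integer using (+_)
open import Data.Rational using (ℚ; 0ℚ; _/_; _÷_; _+_; _-_; _*_; ≢-nonZero)
open import Data.Rational.Properties using (_≟_)
open import Data.Product using (Σ; _×_)
open import Relation.Binary.PropositionalEquality using (_≡_)
open import Relation.Nullary using (yes; no)

IsPrimePower : ℕ → Set
IsPrimePower q = Σ ℕ λ p → Σ ℕ λ e → Prime p × e ≥ 1 × q ≡ p ^ e

ι : ℕ → ℚ
ι n = + n / 1

-- division in ℚ with the convention x / 0 = 0 (only used with nonzero divisors)
_//_ : ℚ → ℚ → ℚ
x // y with y ≟ 0ℚ
... | yes _ = 0ℚ
... | no y≢0 = _÷_ x y {{≢-nonZero y≢0}}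

k : ℕ → ℕ
k n = (n ∸ 1) ℕ./ 2

β : ℕ → ℕ → ℚ
β q n = ι (q ^ ((n ∸ 1) % 2)) * ((ι (q ^ (2 ℕ.* k n)) - ι 1) // (ι (q ^ 2) - ι 1))

α : ℕ → ℕ → ℚ
α q n = β q n - ((ι (q ^ k n) - ι 1) // (ι q - ι 1))

γ : ℕ → ℕ → ℕ → ℚ
γ q m n = α q n + (ι (q ^ k n) // ι m)

module Submission where

-- The sequences are explicit in the parity of n.  Writing j = k(n), they are
--   β_{2j+1} = S_j,   β_{2j+2} = q S_j,   α_n = β_n - T_j,   γ_n = α_n + U_j,
-- with S_j = (q^{2j}-1)/(q²-1), T_j = (q^j-1)/(q-1) and U_j = q^j/m.
-- S and T are geometric sums, so S_{j+1} = q² S_j + 1 and T_{j+1} = q T_j + 1,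
-- and U_{j+1} = q U_j.  Hence β steps by  β_{2j+2} = q β_{2j+1}  and
-- β_{2j+3} = q β_{2j+2} + 1,  which is the first β-recurrence; the α and γ
-- recurrences follow from these steps together with those of T and U.
-- The second β-recurrence comes from the parity-free "balance" identity
--   (q-1-m) α_n + β_n + m γ_n = q β_n + 1,
-- which only uses (q-1) T_j = q^j - 1 = m U_j - 1.

open import Defs
open import Data.Nat as ℕ using (ℕ; zero; suc; _∸_; _≤_; _%_; _^_; s≤s; z≤n)
import Data.Nat.Properties as ℕP
open import Data.Nat.DivMod using (m*n/n≡m; m*n%n≡0; [m+kn]%n≡m%n; +-distrib-/)
open import Data.Nat.Divisibility using (_∣_; ∣⇒≤)
open import Data.Nat.Primality using (prime⇒nonTrivial)
import Data.Nat.Coprimality as Coprimality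
open import Data.Integer as ℤ using (+_)
import Data.Integer.Properties as ℤP
open import Data.Rational using (ℚ; 0ℚ; 1ℚ; mkℚ; ↥_; _+_; _-_; _*_; 1/_; ≢-nonZero)
open import Data.Rational.Properties
  using (_≟_; normalize-coprime; /-cong; *-assoc; *-identityˡ; *-identityʳ; *-zeroʳ;
         *-inverseʳ; +-identityˡ; +-identityʳ)
open import Data.Rational.Solver using (module +-*-Solver)
open import Data.Product using (_×_; _,_)
open import Data.Empty using (⊥-elim)
open import Relation.Binary.PropositionalEquality
open import Relation.Nullary using (yes; no)

open +-*-Solver
open ≡-Reasoning

-- ι n is the canonical fraction n/1, so ι-images can be compared through numerators.
ι-normal : ∀ n → ι n ≡ mkℚ (+ n) 0 (Coprimality.sym (Coprimality.1-coprimeTo n))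
ι-normal n = normalize-coprime (Coprimality.sym (Coprimality.1-coprimeTo n))

ι-+ : ∀ a b → ι (a ℕ.+ b) ≡ ι a + ι b
ι-+ a b = trans (/-cong {+ (a ℕ.+ b)} {1} {+ a ℤ.* + 1 ℤ.+ + b ℤ.* + 1} {1} numerators refl)
                (sym (cong₂ _+_ (ι-normal a) (ι-normal b)))
  where
  numerators : + (a ℕ.+ b) ≡ + a ℤ.* + 1 ℤ.+ + b ℤ.* + 1
  numerators = trans (ℤP.pos-+ a b)
                     (sym (cong₂ ℤ._+_ (ℤP.*-identityʳ (+ a)) (ℤP.*-identityʳ (+ b))))

ι-* : ∀ a b → ι (a ℕ.* b) ≡ ι a * ι b
ι-* a b = trans (/-cong {+ (a ℕ.* b)} {1} {+ a ℤ.* + b} {1} (ℤP.pos-* a b) refl)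
                (sym (cong₂ _*_ (ι-normal a) (ι-normal b)))

ι-∸ : ∀ a b → b ≤ a → ι (a ∸ b) ≡ ι a - ι b
ι-∸ a b b≤a = begin
  ι (a ∸ b)                ≡⟨ solve 2 (λ x y → x := x :+ y :- y) refl (ι (a ∸ b)) (ι b) ⟩
  ι (a ∸ b) + ι b - ι b    ≡⟨ cong (_- ι b) (sym (ι-+ (a ∸ b) b)) ⟩
  ι (a ∸ b ℕ.+ b) - ι b    ≡⟨ cong (λ c → ι c - ι b) (ℕP.m∸n+n≡m b≤a) ⟩
  ι a - ι b                ∎

ι-injective : ∀ {a b} → ι a ≡ ι b → a ≡ b
ι-injective {a} {b} eq =
  ℤP.+-injective (cong ↥_ (trans (sym (ι-normal a)) (trans eq (ι-normal b))))

ι-difference≢0 : ∀ {a b} → a ≢ b → ι a - ι b ≢ 0ℚ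
ι-difference≢0 {a} {b} a≢b eq = a≢b (ι-injective (begin
  ι a                 ≡⟨ solve 2 (λ x y → x := x :- y :+ y) refl (ι a) (ι b) ⟩
  ι a - ι b + ι b     ≡⟨ cong (_+ ι b) eq ⟩
  0ℚ + ι b            ≡⟨ +-identityˡ (ι b) ⟩
  ι b                 ∎))

//-cancel : ∀ x {y} → y ≢ 0ℚ → (x // y) * y ≡ x
//-cancel x {y} y≢0 with y ≟ 0ℚ
... | yes y≡0 = ⊥-elim (y≢0 y≡0)
... | no y≢0′ = begin
  x * 1/ y * y     ≡⟨ solve 3 (λ a b c → a :* c :* b := a :* (b :* c)) refl x y (1/ y) ⟩
  x * (y * 1/ y)   ≡⟨ cong (x *_) (*-inverseʳ y) ⟩
  x * 1ℚ           ≡⟨ *-identityʳ x ⟩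
  x                ∎
  where instance _ = ≢-nonZero y≢0′

//-unique : ∀ {x y z} → y ≢ 0ℚ → z * y ≡ x → x // y ≡ z
//-unique {y = y} {z} y≢0 refl with y ≟ 0ℚ
... | yes y≡0 = ⊥-elim (y≢0 y≡0)
... | no y≢0′ = trans (*-assoc z y (1/ y)) (trans (cong (z *_) (*-inverseʳ y)) (*-identityʳ z))
  where instance _ = ≢-nonZero y≢0′

*-//-assoc : ∀ x y z → (x * y) // z ≡ x * (y // z)
*-//-assoc x y z with z ≟ 0ℚ
... | yes _ = sym (*-zeroʳ x)
... | no z≢0 = *-assoc x y (1/ z)
  where instance _ = ≢-nonZero z≢0

geom : ℕ → ℕ → ℚ
geom r j = (ι (r ^ j) - ι 1) // (ι r - ι 1)

geom-mul : ∀ {r} → r ≢ 1 → ∀ j → geom r j * (ι r - 1ℚ) ≡ ι (r ^ j) - 1ℚ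
geom-mul r≢1 j = //-cancel _ (ι-difference≢0 r≢1)

geom-suc : ∀ {r} → r ≢ 1 → ∀ j → geom r (suc j) ≡ ι r * geom r j + 1ℚ
geom-suc {r} r≢1 j = //-unique (ι-difference≢0 r≢1) (begin
  (R * G + 1ℚ) * (R - 1ℚ)        ≡⟨ solve 2 (λ x g → (x :* g :+ con 1ℚ) :* (x :- con 1ℚ)
                                       := x :* (g :* (x :- con 1ℚ)) :+ x :- con 1ℚ) refl R G ⟩
  R * (G * (R - 1ℚ)) + R - 1ℚ    ≡⟨ cong (λ e → R * e + R - 1ℚ) (geom-mul r≢1 j) ⟩
  R * (ι (r ^ j) - 1ℚ) + R - 1ℚ  ≡⟨ solve 2 (λ x p → x :* (p :- con 1ℚ) :+ x :- con 1ℚ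
                                       := x :* p :- con 1ℚ) refl R (ι (r ^ j)) ⟩
  R * ι (r ^ j) - 1ℚ             ≡⟨ cong (_- 1ℚ) (sym (ι-* r (r ^ j))) ⟩
  ι (r ^ suc j) - 1ℚ             ∎)
  where R = ι r
        G = geom r j

double-suc : ∀ j → 2 ℕ.* suc j ≡ suc (suc (2 ℕ.* j))
double-suc j = ℕP.*-suc 2 j

half-even : ∀ j → (2 ℕ.* j) ℕ./ 2 ≡ j
half-even j = trans (cong (ℕ._/ 2) (ℕP.*-comm 2 j)) (m*n/n≡m j 2)

rem-even : ∀ j → (2 ℕ.* j) % 2 ≡ 0
rem-even j = trans (cong (_% 2) (ℕP.*-comm 2 j)) (m*n%n≡0 j 2)

-- ⌊(2j+1)/2⌋ = j, since the remainders 1 and 0 do not carry.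
half-odd : ∀ j → suc (2 ℕ.* j) ℕ./ 2 ≡ j
half-odd j = begin
  (1 ℕ.+ 2 ℕ.* j) ℕ./ 2   ≡⟨ +-distrib-/ 1 (2 ℕ.* j) no-carry ⟩
  0 ℕ.+ (2 ℕ.* j) ℕ./ 2   ≡⟨ half-even j ⟩
  j                       ∎
  where no-carry : 1 ℕ.+ (2 ℕ.* j) % 2 ℕ.< 2
        no-carry = subst (λ r → 1 ℕ.+ r ℕ.< 2) (sym (rem-even j)) ℕP.≤-refl

rem-odd : ∀ j → suc (2 ℕ.* j) % 2 ≡ 1
rem-odd j = trans (cong (λ i → suc i % 2) (ℕP.*-comm 2 j)) ([m+kn]%n≡m%n 1 j 2)

rem-complement : ∀ i → i % 2 ℕ.+ suc i % 2 ≡ 1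
rem-complement zero    = refl
rem-complement (suc i) = trans (ℕP.+-comm (suc i % 2) (i % 2)) (rem-complement i)

data Parity : ℕ → Set where
  even : ∀ j → Parity (2 ℕ.* j)
  odd  : ∀ j → Parity (suc (2 ℕ.* j))

parity : ∀ i → Parity i
parity zero = even 0
parity (suc i) with parity i
... | even j = odd j
... | odd j  = subst Parity (double-suc j) (even (suc j))

at-even : (P : ℕ → Set) → (∀ j → P (suc (suc (2 ℕ.* j)))) → ∀ n → 1 ≤ n → P (2 ℕ.* n)
at-even P p (suc j) _ = subst P (sym (double-suc j)) (p j)

at-odd : (P : ℕ → ℕ → Set) → (∀ j → P (suc (suc (suc (2 ℕ.* j)))) (suc (suc (2 ℕ.* j)))) →
         ∀ n → 1 ≤ n → P (2 ℕ.* n ℕ.+ 1) (2 ℕ.* n)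
at-odd P p (suc j) _ = subst₂ P (sym odd-index) (sym (double-suc j)) (p j)
  where odd-index : 2 ℕ.* suc j ℕ.+ 1 ≡ suc (suc (suc (2 ℕ.* j)))
        odd-index = trans (ℕP.+-comm (2 ℕ.* suc j) 1) (cong suc (double-suc j))

module Recurrences (q m : ℕ) (q≥2 : 2 ≤ q) (m≥1 : 1 ≤ m) (m≤q-1 : m ≤ q ∸ 1) where

  Q M : ℚ
  Q = ι q
  M = ι m

  S T U : ℕ → ℚ
  S j = (ι (q ^ (2 ℕ.* j)) - ι 1) // (ι (q ^ 2) - ι 1)
  T j = geom q j
  U j = ι (q ^ j) // M

  q≢1 : q ≢ 1
  q≢1 q≡1 = ℕP.<⇒≢ q≥2 (sym q≡1)

  q²≢1 : q ^ 2 ≢ 1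
  q²≢1 q²≡1 = ℕP.<⇒≢ (ℕP.^-monoʳ-< q q≥2 {0} {2} (s≤s z≤n)) (sym q²≡1)

  -- The coefficients q - 1 and q - 1 - m are computed in ℕ without truncation.
  ι-q∸1 : ι (q ∸ 1) ≡ Q - 1ℚ
  ι-q∸1 = ι-∸ q 1 (ℕP.≤-trans (s≤s z≤n) q≥2)

  ι-q∸1∸m : ι (q ∸ 1 ∸ m) ≡ Q - 1ℚ - M
  ι-q∸1∸m = trans (ι-∸ (q ∸ 1) m m≤q-1) (cong (_- M) ι-q∸1)

  -- S is the geometric sum in ratio q².
  S-suc : ∀ j → S (suc j) ≡ Q * (Q * S j) + 1ℚ
  S-suc j = begin
    S (suc j)                        ≡⟨ S-geom (suc j) ⟩
    geom (q ^ 2) (suc j)             ≡⟨ geom-suc q²≢1 j ⟩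
    ι (q ^ 2) * geom (q ^ 2) j + 1ℚ  ≡⟨ cong₂ (λ a g → a * g + 1ℚ) ι-q² (sym (S-geom j)) ⟩
    Q * Q * S j + 1ℚ                 ≡⟨ cong (_+ 1ℚ) (*-assoc Q Q (S j)) ⟩
    Q * (Q * S j) + 1ℚ               ∎
    where
    S-geom : ∀ j → S j ≡ geom (q ^ 2) j
    S-geom j = cong (λ e → (ι e - ι 1) // (ι (q ^ 2) - ι 1)) (sym (ℕP.^-*-assoc q 2 j))
    ι-q² : ι (q ^ 2) ≡ Q * Q
    ι-q² = trans (ι-* q (q ℕ.* 1)) (cong (λ c → Q * ι c) (ℕP.*-identityʳ q))

  U-suc : ∀ j → U (suc j) ≡ Q * U j
  U-suc j = trans (cong (_// M) (ι-* q (q ^ j))) (*-//-assoc Q (ι (q ^ j)) M)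

  β-odd : ∀ j → β q (suc (2 ℕ.* j)) ≡ S j
  β-odd j = trans (cong₂ (λ r h → ι (q ^ r) * S h) (rem-even j) (half-even j)) (*-identityˡ (S j))

  β-even : ∀ j → β q (suc (suc (2 ℕ.* j))) ≡ Q * S j
  β-even j = trans (cong₂ (λ r h → ι (q ^ r) * S h) (rem-odd j) (half-odd j))
                   (cong (λ c → ι c * S j) (ℕP.*-identityʳ q))

  α-at : ∀ i {h} → i ℕ./ 2 ≡ h → α q (suc i) ≡ β q (suc i) - T h
  α-at i i/2≡h = cong (λ h → β q (suc i) - T h) i/2≡h

  γ-at : ∀ i {h} → i ℕ./ 2 ≡ h → γ q m (suc i) ≡ α q (suc i) + U h
  γ-at i i/2≡h = cong (λ h → α q (suc i) + U h) i/2≡h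

  half-even-suc : ∀ j → suc (suc (2 ℕ.* j)) ℕ./ 2 ≡ suc j
  half-even-suc j = trans (cong (ℕ._/ 2) (sym (double-suc j))) (half-even (suc j))

  β-even-step : ∀ j → β q (suc (suc (2 ℕ.* j))) ≡ Q * β q (suc (2 ℕ.* j))
  β-even-step j = trans (β-even j) (cong (Q *_) (sym (β-odd j)))

  β-odd-step : ∀ j → β q (suc (suc (suc (2 ℕ.* j)))) ≡ Q * β q (suc (suc (2 ℕ.* j))) + 1ℚ
  β-odd-step j = begin
    β q (suc (suc (suc (2 ℕ.* j))))    ≡⟨ cong (λ i → β q (suc i)) (sym (double-suc j)) ⟩
    β q (suc (2 ℕ.* suc j))            ≡⟨ β-odd (suc j) ⟩
    S (suc j)                          ≡⟨ S-suc j ⟩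
    Q * (Q * S j) + 1ℚ                 ≡⟨ cong (λ b → Q * b + 1ℚ) (sym (β-even j)) ⟩
    Q * β q (suc (suc (2 ℕ.* j))) + 1ℚ ∎

  β-rec : ∀ n → 2 ≤ n → β q n ≡ Q * β q (n ∸ 1) + ι (n % 2)
  β-rec (suc (suc i)) (s≤s (s≤s _)) with parity i
  ... | even j = trans (β-even-step j)
                       (sym (trans (cong (λ r → Q * β q (suc (2 ℕ.* j)) + ι r) (rem-even j))
                                   (+-identityʳ _)))
  ... | odd j  = trans (β-odd-step j)
                       (cong (λ r → Q * β q (suc (suc (2 ℕ.* j))) + ι r) (sym (rem-odd j)))

  -- The parity-free balance identity; it uses (q-1) T_h = q^h - 1 = m U_h - 1.
  balance : ∀ n → ι (q ∸ 1 ∸ m) * α q n + β q n + M * γ q m n ≡ Q * β q n + 1ℚ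
  balance n = begin
    ι (q ∸ 1 ∸ m) * (b - t) + b + M * (b - t + u)   ≡⟨ cong (λ c → c * (b - t) + b + M * (b - t + u)) ι-q∸1∸m ⟩
    (Q - 1ℚ - M) * (b - t) + b + M * (b - t + u)    ≡⟨ solve 5 (λ Q' M' b' t' u' →
                                                         (Q' :- con 1ℚ :- M') :* (b' :- t') :+ b' :+ M' :* (b' :- t' :+ u')
                                                         := Q' :* b' :- t' :* (Q' :- con 1ℚ) :+ u' :* M') refl Q M b t u ⟩
    Q * b - t * (Q - 1ℚ) + u * M                    ≡⟨ cong₂ (λ d e → Q * b - d + e) (geom-mul q≢1 h) (//-cancel _ M≢0) ⟩
    Q * b - (x - 1ℚ) + x                            ≡⟨ solve 3 (λ Q' b' x' → Q' :* b' :- (x' :- con 1ℚ) :+ x' := Q' :* b' :+ con 1ℚ) refl Q b x ⟩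
    Q * b + 1ℚ                                      ∎
    where
    h = k n
    b = β q n
    t = T h
    u = U h
    x = ι (q ^ h)
    M≢0 : M ≢ 0ℚ
    M≢0 M≡0 = ℕP.<⇒≢ m≥1 (sym (ι-injective {m} {0} M≡0))

  -- Second recurrence for β, from the first and the balance identity.
  β-rec′ : ∀ n → 2 ≤ n →
           β q n ≡ ι (q ∸ 1 ∸ m) * α q (n ∸ 1) + β q (n ∸ 1) + M * γ q m (n ∸ 1) - ι ((n ∸ 1) % 2)
  β-rec′ (suc (suc i)) 2≤n@(s≤s (s≤s _)) = begin
    β q (suc (suc i))                            ≡⟨ β-rec (suc (suc i)) 2≤n ⟩
    Q * b + ι (i % 2)                            ≡⟨ solve 3 (λ a c d → a :+ c := a :+ (c :+ d) :- d) refl (Q * b) (ι (i % 2)) (ι (suc i % 2)) ⟩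
    Q * b + (ι (i % 2) + ι (suc i % 2)) - ι (suc i % 2)
                                                 ≡⟨ cong (λ c → Q * b + c - ι (suc i % 2)) (trans (sym (ι-+ (i % 2) (suc i % 2))) (cong ι (rem-complement i))) ⟩
    Q * b + 1ℚ - ι (suc i % 2)                   ≡⟨ cong (_- ι (suc i % 2)) (sym (balance (suc i))) ⟩
    ι (q ∸ 1 ∸ m) * α q (suc i) + b + M * γ q m (suc i) - ι (suc i % 2) ∎
    where b = β q (suc i)

  α-even-rec : ∀ j → α q (suc (suc (2 ℕ.* j))) ≡ α q (suc (2 ℕ.* j)) + ι (q ∸ 1) * β q (suc (2 ℕ.* j))
  α-even-rec j = begin
    α q (suc (suc (2 ℕ.* j)))    ≡⟨ α-at (suc (2 ℕ.* j)) (half-odd j) ⟩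
    β q (suc (suc (2 ℕ.* j))) - T j ≡⟨ cong (_- T j) (β-even-step j) ⟩
    Q * b - T j                  ≡⟨ solve 3 (λ Q' b' t' → Q' :* b' :- t' := b' :- t' :+ (Q' :- con 1ℚ) :* b') refl Q b (T j) ⟩
    b - T j + (Q - 1ℚ) * b       ≡⟨ cong₂ (λ a c → a + c * b) (sym (α-at (2 ℕ.* j) (half-even j))) (sym ι-q∸1) ⟩
    α q (suc (2 ℕ.* j)) + ι (q ∸ 1) * b ∎
    where b = β q (suc (2 ℕ.* j))

  α-odd-rec : ∀ j → α q (suc (suc (suc (2 ℕ.* j)))) ≡ Q * α q (suc (suc (2 ℕ.* j)))
  α-odd-rec j = begin
    α q (suc (suc (suc (2 ℕ.* j))))   ≡⟨ α-at (suc (suc (2 ℕ.* j))) (half-even-suc j) ⟩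
    β q (suc (suc (suc (2 ℕ.* j)))) - T (suc j)
                                      ≡⟨ cong₂ _-_ (β-odd-step j) (geom-suc q≢1 j) ⟩
    Q * b + 1ℚ - (Q * T j + 1ℚ)       ≡⟨ solve 3 (λ Q' b' t' → Q' :* b' :+ con 1ℚ :- (Q' :* t' :+ con 1ℚ) := Q' :* (b' :- t')) refl Q b (T j) ⟩
    Q * (b - T j)                     ≡⟨ cong (Q *_) (sym (α-at (suc (2 ℕ.* j)) (half-odd j))) ⟩
    Q * α q (suc (suc (2 ℕ.* j)))     ∎
    where b = β q (suc (suc (2 ℕ.* j)))

  γ-even-rec : ∀ j → γ q m (suc (suc (2 ℕ.* j))) ≡ ι (q ∸ 1) * β q (suc (2 ℕ.* j)) + γ q m (suc (2 ℕ.* j))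
  γ-even-rec j = begin
    γ q m (suc (suc (2 ℕ.* j)))   ≡⟨ γ-at (suc (2 ℕ.* j)) (half-odd j) ⟩
    α q (suc (suc (2 ℕ.* j))) + U j ≡⟨ cong (_+ U j) (α-even-rec j) ⟩
    a + c + U j                   ≡⟨ solve 3 (λ a' c' u' → a' :+ c' :+ u' := c' :+ (a' :+ u')) refl a c (U j) ⟩
    c + (a + U j)                 ≡⟨ cong (λ e → c + e) (sym (γ-at (2 ℕ.* j) (half-even j))) ⟩
    c + γ q m (suc (2 ℕ.* j))     ∎
    where a = α q (suc (2 ℕ.* j))
          c = ι (q ∸ 1) * β q (suc (2 ℕ.* j))

  γ-odd-rec : ∀ j → γ q m (suc (suc (suc (2 ℕ.* j)))) ≡ Q * γ q m (suc (suc (2 ℕ.* j)))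
  γ-odd-rec j = begin
    γ q m (suc (suc (suc (2 ℕ.* j))))  ≡⟨ γ-at (suc (suc (2 ℕ.* j))) (half-even-suc j) ⟩
    α q (suc (suc (suc (2 ℕ.* j)))) + U (suc j)
                                       ≡⟨ cong₂ _+_ (α-odd-rec j) (U-suc j) ⟩
    Q * a + Q * U j                    ≡⟨ solve 3 (λ Q' a' u' → Q' :* a' :+ Q' :* u' := Q' :* (a' :+ u')) refl Q a (U j) ⟩
    Q * (a + U j)                      ≡⟨ cong (Q *_) (sym (γ-at (suc (2 ℕ.* j)) (half-odd j))) ⟩
    Q * γ q m (suc (suc (2 ℕ.* j)))    ∎
    where a = α q (suc (suc (2 ℕ.* j)))

primePower≥2 : ∀ {q} → IsPrimePower q → 2 ≤ q
primePower≥2 (p , e , p-prime , e≥1 , refl) =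
  ℕP.^-monoʳ-< p (ℕ.nonTrivial⇒n>1 p {{prime⇒nonTrivial p-prime}}) {0} {e} e≥1

divisor≤ : ∀ {q m} → 2 ≤ q → m ∣ q ∸ 1 → m ≤ q ∸ 1
divisor≤ (s≤s (s≤s _)) m∣q-1 = ∣⇒≤ m∣q-1

lemma2 : (q m : ℕ) → IsPrimePower q → 1 ≤ m → m ∣ q ∸ 1 →
    ((n : ℕ) → 1 ≤ n → α q (2 ℕ.* n) ≡ α q (2 ℕ.* n ∸ 1) + ι (q ∸ 1) * β q (2 ℕ.* n ∸ 1))
    × ((n : ℕ) → 1 ≤ n → α q (2 ℕ.* n ℕ.+ 1) ≡ ι q * α q (2 ℕ.* n))
    × ((n : ℕ) → 2 ≤ n → β q n ≡ ι q * β q (n ∸ 1) + ι (n % 2))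
    × ((n : ℕ) → 2 ≤ n → β q n ≡ ι (q ∸ 1 ∸ m) * α q (n ∸ 1) + β q (n ∸ 1) + ι m * γ q m (n ∸ 1) - ι ((n ∸ 1) % 2))
    × ((n : ℕ) → 1 ≤ n → γ q m (2 ℕ.* n) ≡ ι (q ∸ 1) * β q (2 ℕ.* n ∸ 1) + γ q m (2 ℕ.* n ∸ 1))
    × ((n : ℕ) → 1 ≤ n → γ q m (2 ℕ.* n ℕ.+ 1) ≡ ι q * γ q m (2 ℕ.* n))
lemma2 q m q-primePower m≥1 m∣q-1 =
    at-even (λ n → α q n ≡ α q (n ∸ 1) + ι (q ∸ 1) * β q (n ∸ 1)) α-even-rec
  , at-odd (λ n n′ → α q n ≡ ι q * α q n′) α-odd-rec
  , β-rec
  , β-rec′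
  , at-even (λ n → γ q m n ≡ ι (q ∸ 1) * β q (n ∸ 1) + γ q m (n ∸ 1)) γ-even-rec
  , at-odd (λ n n′ → γ q m n ≡ ι q * γ q m n′) γ-odd-rec
  where
  q≥2 = primePower≥2 q-primePower
  open Recurrences q m q≥2 m≥1 (divisor≤ q≥2 m∣q-1)
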